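{- For every base $b\ge 2$, there exist infinitely many positive integers that are not $b$-ARH numbers.
   Context: For a positive integer $N$, $s_b(N)$ is the sum of the base-$b$ digits of $N$, and the reversal $N^R$ is the integer obtained by writing the base-$b$ digits of $N$ in reverse order. A positive integer $N$ is a $b$-ARH number if there exists a positive integer $M$ such that $N=Ms_b(N)+(Ms_b(N))^R$. -}

module Defs where

open import Data.Nat using (ℕ; zero; suc; _+_; _*_; _≤_; _<_; NonZero)
open import Data.Nat.DivMod using (_/_; _%_)
open import Data.List using (List; []; _∷_; reverse)
open import Data.Nat.ListAction using (sum)
open import Relation.Binary.PropositionalEquality using (_≡_)
open import Data.Product using (Σ; ∃; _×_)

-- Base-b digits of n, least significant first (fuel-based; fuel n suffices
-- for b ≥ 2). digits b 0 = [] (0 has no nonzero digits; irrelevant here).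
digitsAux : (b : ℕ) → .{{NonZero b}} → ℕ → ℕ → List ℕ
digitsAux b zero n = []
digitsAux b (suc fuel) zero = []
digitsAux b (suc fuel) n@(suc _) = (n % b) ∷ digitsAux b fuel (n / b)

digits : (b : ℕ) → .{{NonZero b}} → ℕ → List ℕ
digits b n = digitsAux b n n

fromDigits : ℕ → List ℕ → ℕ
fromDigits b [] = 0
fromDigits b (d ∷ ds) = d + b * fromDigits b ds

digitSum : (b : ℕ) → .{{NonZero b}} → ℕ → ℕ
digitSum b n = sum (digits b n)

rev : (b : ℕ) → .{{NonZero b}} → ℕ → ℕ
rev b n = fromDigits b (reverse (digits b n))

IsARH : (b : ℕ) → .{{NonZero b}} → ℕ → Set
IsARH b N = 1 ≤ N × Σ ℕ (λ M → 1 ≤ M × N ≡ (M * digitSum b N + rev b (M * digitSum b N)))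

-- Write m = b + 1.  Since b ≡ -1 (mod m), a number is congruent mod m
-- to the alternating sum of its base-b digits, and reversing the digit list
-- only changes the sign of that alternating sum.  Hence m ∣ X implies
-- m ∣ X^R.  If N = X + X^R with X = M·s_b(N) and m ∣ s_b(N), then m ∣ X,
-- m ∣ X^R and so m ∣ N.  Therefore every N with m ∣ s_b(N) and m ∤ N is not
-- b-ARH.  The numbers N_k = b^(2k)·N_0, where N_0 has digits 1, 1, b-1
-- (least significant first), all have digit sum b + 1 and N_k ≡ b - 1 (mod m).
module Submission where

open import Defs
open import Data.Nat using (ℕ; zero; suc; _+_; _*_; _≤_; _<_; z≤n; s≤s; NonZero)
open import Data.Nat.Properties
  using (≤-refl; ≤-trans; ≤-pred; n≤1+n; m≤n*m; +-mono-≤; *-comm; +-comm; +-identityʳ)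
open import Data.Nat.DivMod
  using (_/_; _%_; m/n<m; m≡m%n+[m/n]*n; [m+kn]%n≡m%n; m<n⇒m%n≡m; m<n⇒m/n≡0; m*n/n≡m; +-distrib-/-∣ʳ)
open import Data.Nat.Divisibility using (_∣_; divides; ∣-refl; ∣m∣n⇒∣m+n; ∣n⇒∣m*n; n∣m⇒m%n≡0)
open import Data.Nat.ListAction using (sum)
open import Data.Nat.Tactic.RingSolver using (solve-∀)
open import Data.List using (List; []; _∷_; reverse; _++_; [_]; length)
open import Data.List.Properties using (unfold-reverse; length-reverse)
open import Data.Product using (Σ; _×_; _,_)
open import Relation.Nullary using (¬_)
open import Relation.Binary.PropositionalEquality
  using (_≡_; refl; sym; trans; cong; cong₂; subst; module ≡-Reasoning)

module Digits (b : ℕ) .{{_ : NonZero b}} (1<b : 1 < b) where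

  -- One division step strictly decreases a positive number; this is what
  -- makes fuel n enough to expand n.
  quotient< : ∀ n → suc n / b < suc n
  quotient< n = m/n<m (suc n) b 1<b

  digitsAux-fuel : ∀ f g n → n ≤ f → n ≤ g → digitsAux b f n ≡ digitsAux b g n
  digitsAux-fuel zero    zero    zero    _ _ = refl
  digitsAux-fuel zero    (suc g) zero    _ _ = refl
  digitsAux-fuel (suc f) zero    zero    _ _ = refl
  digitsAux-fuel (suc f) (suc g) zero    _ _ = refl
  digitsAux-fuel (suc f) (suc g) (suc n) n<f n<g =
    cong (suc n % b ∷_) (digitsAux-fuel f g (suc n / b)
      (≤-pred (≤-trans (quotient< n) n<f)) (≤-pred (≤-trans (quotient< n) n<g)))

  fromDigits-digitsAux : ∀ f n → n ≤ f → fromDigits b (digitsAux b f n) ≡ n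
  fromDigits-digitsAux zero    zero    _   = refl
  fromDigits-digitsAux (suc f) zero    _   = refl
  fromDigits-digitsAux (suc f) (suc n) n<f = begin
    suc n % b + b * fromDigits b (digitsAux b f (suc n / b))
      ≡⟨ cong (λ w → suc n % b + b * w)
              (fromDigits-digitsAux f (suc n / b) (≤-pred (≤-trans (quotient< n) n<f))) ⟩
    suc n % b + b * (suc n / b)  ≡⟨ cong (suc n % b +_) (*-comm b (suc n / b)) ⟩
    suc n % b + suc n / b * b    ≡⟨ sym (m≡m%n+[m/n]*n (suc n) b) ⟩
    suc n                        ∎
    where open ≡-Reasoning

  fromDigits-digits : ∀ n → fromDigits b (digits b n) ≡ n
  fromDigits-digits n = fromDigits-digitsAux n n ≤-refl

  -- Unfolding 'digits' once: the fuel left over after one step is enough.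
  digits-suc : ∀ n → digits b (suc n) ≡ suc n % b ∷ digits b (suc n / b)
  digits-suc n = cong (suc n % b ∷_)
    (digitsAux-fuel n (suc n / b) (suc n / b) (≤-pred (quotient< n)) ≤-refl)

  -- The least significant digit of d + b·q is d, and the remaining digits are
  -- those of q (positivity excludes the empty expansion of 0).
  digits-cons : ∀ d q → d < b → 0 < d + b * q → digits b (d + b * q) ≡ d ∷ digits b q
  digits-cons d q d<b _ with d + b * q in eq
  ... | suc n = trans (digits-suc n) (cong₂ (λ x y → x ∷ digits b y) last-digit quotient)
    where
    eq′ : suc n ≡ d + q * b
    eq′ = trans (sym eq) (cong (d +_) (*-comm b q))
    last-digit : suc n % b ≡ d
    last-digit = trans (cong (_% b) eq′) (trans ([m+kn]%n≡m%n d q b) (m<n⇒m%n≡m d<b))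
    quotient : suc n / b ≡ q
    quotient = trans (cong (_/ b) eq′) (trans (+-distrib-/-∣ʳ d (divides q refl))
                 (cong₂ _+_ (m<n⇒m/n≡0 d<b) (m*n/n≡m q b)))

module AlternatingSum where
  open import Data.Integer as ℤ using (ℤ; +_; -_; _-_)
  open import Data.Integer.Properties using (pos-+; pos-*)
  import Data.Integer.Divisibility.Signed as ℤ∣
  open ℤ∣ using (∣m∣n⇒∣m-n; ∣ᵤ⇒∣; ∣⇒∣ᵤ) renaming (_∣_ to _∣ℤ_; divides to dividesℤ)
  open import Data.Integer.Tactic.RingSolver renaming (solve-∀ to ℤ-solve)

  ∣-minuend⇒∣-subtrahend : ∀ {m x y} → m ∣ℤ x → m ∣ℤ x - y → m ∣ℤ y
  ∣-minuend⇒∣-subtrahend {m} {x} {y} m∣x m∣x-y =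
    subst (m ∣ℤ_) (identity x y) (∣m∣n⇒∣m-n m∣x m∣x-y)
    where identity : ∀ x y → x - (x - y) ≡ y
          identity = ℤ-solve

  ∣-subtrahend⇒∣-minuend : ∀ {m x y} → m ∣ℤ x - y → m ∣ℤ y → m ∣ℤ x
  ∣-subtrahend⇒∣-minuend {m} {x} {y} m∣x-y m∣y =
    subst (m ∣ℤ_) (identity x y) (ℤ∣.∣m∣n⇒∣m+n m∣x-y m∣y)
    where identity : ∀ x y → x - y ℤ.+ y ≡ x
          identity = ℤ-solve

  alt : List ℕ → ℤ
  alt []       = + 0
  alt (d ∷ ds) = + d - alt ds

  sign : ℕ → ℤ
  sign zero    = + 1
  sign (suc n) = - sign n

  alt-snoc : ∀ ds d → alt (ds ++ [ d ]) ≡ alt ds ℤ.+ sign (length ds) ℤ.* + d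
  alt-snoc []       d = identity (+ d)
    where identity : ∀ e → e - + 0 ≡ + 0 ℤ.+ + 1 ℤ.* e
          identity = ℤ-solve
  alt-snoc (x ∷ ds) d = begin
    + x - alt (ds ++ [ d ])                        ≡⟨ cong (λ w → + x - w) (alt-snoc ds d) ⟩
    + x - (alt ds ℤ.+ sign (length ds) ℤ.* + d)   ≡⟨ identity (+ x) (alt ds) (sign (length ds)) (+ d) ⟩
    (+ x - alt ds) ℤ.+ - sign (length ds) ℤ.* + d  ∎
    where
    open ≡-Reasoning
    identity : ∀ a b s e → a - (b ℤ.+ s ℤ.* e) ≡ (a - b) ℤ.+ (- s) ℤ.* e
    identity = ℤ-solve

  alt-reverse : ∀ ds → alt (reverse ds) ≡ - sign (length ds) ℤ.* alt ds
  alt-reverse []       = refl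
  alt-reverse (d ∷ ds) = begin
    alt (reverse (d ∷ ds))                                 ≡⟨ cong alt (unfold-reverse d ds) ⟩
    alt (reverse ds ++ [ d ])                              ≡⟨ alt-snoc (reverse ds) d ⟩
    alt (reverse ds) ℤ.+ sign (length (reverse ds)) ℤ.* + d
      ≡⟨ cong₂ (λ a n → a ℤ.+ sign n ℤ.* + d) (alt-reverse ds) (length-reverse ds) ⟩
    - s ℤ.* alt ds ℤ.+ s ℤ.* + d                           ≡⟨ identity s (alt ds) (+ d) ⟩
    - (- s) ℤ.* (+ d - alt ds)                             ∎
    where
    open ≡-Reasoning
    s : ℤ
    s = sign (length ds)
    identity : ∀ s a e → - s ℤ.* a ℤ.+ s ℤ.* e ≡ - (- s) ℤ.* (e - a)
    identity = ℤ-solve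

  fromDigits≡alt : ∀ b ds → + suc b ∣ℤ + fromDigits b ds - alt ds
  fromDigits≡alt b []       = dividesℤ (+ 0) refl
  fromDigits≡alt b (d ∷ ds) =
    subst (+ suc b ∣ℤ_) (sym expand)
      (ℤ∣.∣m∣n⇒∣m+n (ℤ∣.∣n⇒∣m*n (+ b) (fromDigits≡alt b ds)) (dividesℤ (alt ds) refl))
    where
    F : ℕ
    F = fromDigits b ds
    identity : ∀ d b f a → d ℤ.+ b ℤ.* f - (d - a) ≡ b ℤ.* (f - a) ℤ.+ a ℤ.* (+ 1 ℤ.+ b)
    identity = ℤ-solve
    expand : + (d + b * F) - (+ d - alt ds) ≡ + b ℤ.* (+ F - alt ds) ℤ.+ alt ds ℤ.* + suc b
    expand = begin
      + (d + b * F) - (+ d - alt ds)             ≡⟨ cong (λ w → w - (+ d - alt ds))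
                                                       (trans (pos-+ d (b * F)) (cong (λ w → + d ℤ.+ w) (pos-* b F))) ⟩
      + d ℤ.+ + b ℤ.* + F - (+ d - alt ds)       ≡⟨ identity (+ d) (+ b) (+ F) (alt ds) ⟩
      + b ℤ.* (+ F - alt ds) ℤ.+ alt ds ℤ.* (+ 1 ℤ.+ + b)
                                                 ≡⟨ cong (λ w → + b ℤ.* (+ F - alt ds) ℤ.+ alt ds ℤ.* w) (sym (pos-+ 1 b)) ⟩
      + b ℤ.* (+ F - alt ds) ℤ.+ alt ds ℤ.* + suc b ∎
      where open ≡-Reasoning

  fromDigits-reverse-∣ : ∀ b ds → suc b ∣ fromDigits b ds → suc b ∣ fromDigits b (reverse ds)
  fromDigits-reverse-∣ b ds m∣F = ∣⇒∣ᵤ m∣F′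
    where
    m∣alt : + suc b ∣ℤ alt ds
    m∣alt = ∣-minuend⇒∣-subtrahend {x = + fromDigits b ds} (∣ᵤ⇒∣ m∣F) (fromDigits≡alt b ds)
    m∣alt′ : + suc b ∣ℤ alt (reverse ds)
    m∣alt′ = subst (+ suc b ∣ℤ_) (sym (alt-reverse ds)) (ℤ∣.∣n⇒∣m*n (- sign (length ds)) m∣alt)
    m∣F′ : + suc b ∣ℤ + fromDigits b (reverse ds)
    m∣F′ = ∣-subtrahend⇒∣-minuend (fromDigits≡alt b (reverse ds)) m∣alt′

module Criterion (b : ℕ) .{{_ : NonZero b}} (1<b : 1 < b) where
  open Digits b 1<b
  open AlternatingSum using (fromDigits-reverse-∣)

  rev-∣ : ∀ X → suc b ∣ X → suc b ∣ rev b X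
  rev-∣ X m∣X = fromDigits-reverse-∣ b (digits b X)
    (subst (suc b ∣_) (sym (fromDigits-digits X)) m∣X)

  -- If N = X + Xᴿ with X = M·s_b(N), both summands are divisible by b + 1.
  not-ARH : ∀ N → suc b ∣ digitSum b N → ¬ suc b ∣ N → ¬ IsARH b N
  not-ARH N m∣s m∤N (_ , M , _ , N≡X+Xᴿ) =
    m∤N (subst (suc b ∣_) (sym N≡X+Xᴿ) (∣m∣n⇒∣m+n m∣X (rev-∣ X m∣X)))
    where
    X : ℕ
    X = M * digitSum b N
    m∣X : suc b ∣ X
    m∣X = ∣n⇒∣m*n M m∣s

-- (4) The witnesses, in base b = a + 2: N₀ has digits 1, 1, b - 1 and
-- N_{k+1} = b²·N_k, i.e. two zero digits are prepended.
module Witnesses (a : ℕ) where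
  private
    b : ℕ
    b = suc (suc a)
    1<b : 1 < b
    1<b = s≤s (s≤s z≤n)
  open Digits b 1<b

  witness : ℕ → ℕ
  witness zero    = 1 + b * (1 + b * (suc a + b * 0))
  witness (suc k) = b * (b * witness k)

  -- Both defining equations in the form "remainder + quotient·(b + 1)".
  witness-zero-mod : witness zero ≡ suc a + (a * a + 2 * a + 2) * suc b
  witness-zero-mod = identity a
    where
    identity : ∀ a → 1 + (2 + a) * (1 + (2 + a) * (suc a + (2 + a) * 0))
                       ≡ suc a + (a * a + 2 * a + 2) * (3 + a)
    identity = solve-∀

  witness-suc-mod : ∀ k → witness (suc k) ≡ witness k + (suc a * witness k) * suc b
  witness-suc-mod k = identity a (witness k)
    where
    identity : ∀ a w → (2 + a) * ((2 + a) * w) ≡ w + (suc a * w) * (3 + a)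
    identity = solve-∀

  -- N_k > k, since each step adds a positive multiple of b + 1.
  witness-large : ∀ k → k < witness k
  witness-large zero    = s≤s z≤n
  witness-large (suc k) =
    subst (suc (suc k) ≤_) (sym (witness-suc-mod k)) (grows (witness k) (witness-large k))
    where
    grows : ∀ w → k < w → suc (suc k) ≤ w + (suc a * w) * suc b
    grows (suc v) k<w = subst (suc (suc k) ≤_) (+-comm ((suc a * suc v) * suc b) (suc v))
                          (+-mono-≤ {1} {(suc a * suc v) * suc b} (s≤s z≤n) k<w)

  witness-pos : ∀ k → 1 ≤ witness k
  witness-pos k = ≤-trans (s≤s z≤n) (witness-large k)

  -- N_k ≡ b - 1 (mod b + 1), since b² ≡ 1.
  witness-mod : ∀ k → witness k % suc b ≡ suc a
  witness-mod zero    = begin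
    witness zero % suc b                          ≡⟨ cong (_% suc b) witness-zero-mod ⟩
    (suc a + (a * a + 2 * a + 2) * suc b) % suc b ≡⟨ [m+kn]%n≡m%n (suc a) (a * a + 2 * a + 2) (suc b) ⟩
    suc a % suc b                                 ≡⟨ m<n⇒m%n≡m (s≤s (s≤s (n≤1+n a))) ⟩
    suc a                                         ∎
    where open ≡-Reasoning
  witness-mod (suc k) = begin
    witness (suc k) % suc b                             ≡⟨ cong (_% suc b) (witness-suc-mod k) ⟩
    (witness k + (suc a * witness k) * suc b) % suc b   ≡⟨ [m+kn]%n≡m%n (witness k) (suc a * witness k) (suc b) ⟩
    witness k % suc b                                   ≡⟨ witness-mod k ⟩
    suc a                                               ∎
    where open ≡-Reasoning

  witness-∤ : ∀ k → ¬ suc b ∣ witness k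
  witness-∤ k m∣w with trans (sym (witness-mod k)) (n∣m⇒m%n≡0 (witness k) (suc b) m∣w)
  ... | ()

  witness-digitSum : ∀ k → digitSum b (witness k) ≡ suc b
  witness-digitSum zero    =
    trans (cong sum digits-witness-zero) (cong (λ n → suc (suc n)) (+-identityʳ (suc a)))
    where
    digits-witness-zero : digits b (witness zero) ≡ 1 ∷ 1 ∷ suc a ∷ []
    digits-witness-zero =
      trans (digits-cons 1 _ 1<b (s≤s z≤n))
        (cong (1 ∷_) (trans (digits-cons 1 _ 1<b (s≤s z≤n))
          (cong (1 ∷_) (digits-cons (suc a) 0 ≤-refl (s≤s z≤n)))))
  witness-digitSum (suc k) = trans (cong sum digits-witness-suc) (witness-digitSum k)
    where
    digits-witness-suc : digits b (witness (suc k)) ≡ 0 ∷ 0 ∷ digits b (witness k)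
    digits-witness-suc =
      trans (digits-cons 0 (b * witness k) (s≤s z≤n) (witness-pos (suc k)))
        (cong (0 ∷_) (digits-cons 0 (witness k) (s≤s z≤n) (≤-trans (witness-pos k) (m≤n*m (witness k) b))))

theorem26 : (b : ℕ) → .{{_ : NonZero b}} → 2 ≤ b →
    (k : ℕ) → Σ ℕ (λ N → k < N × 1 ≤ N × ¬ IsARH b N)
theorem26 (suc (suc a)) 2≤b@(s≤s (s≤s z≤n)) k =
  witness k , witness-large k , witness-pos k ,
  not-ARH (witness k) (subst (suc b ∣_) (sym (witness-digitSum k)) ∣-refl) (witness-∤ k)
  where
  b : ℕ
  b = suc (suc a)
  open Witnesses a
  open Criterion b 2≤b
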